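{- Let $\mathcal{A}$ be a recursive algorithm enumerating a finite set $S$ and assume that $\mathcal{A}$ satisfies the Pyramid condition with time $T^\star$ (for some potential function). Let $\Delta$ be an upper bound on the total number of instructions executed by all iterations on any path in the recursion tree from the root to a leaf. Then for every $k$, $\mathcal{A}$ enumerates the first $k$ elements of $S$ in time $O(kT^\star + \Delta)$.
   Context: Setting (recursive enumeration algorithms): A recursive algorithm $\mathcal{A}$ enumerates ("visits") every element of a finite set $S$ exactly once. Its recursive calls form a recursion tree; an iteration is one execution of the recursive function, excluding the computation done inside the calls it makes recursively, and iterations are identified with nodes of the recursion tree. Each iteration is labeled by the set $X\subseteq S$ of elements visited by that iteration or any of its descendants. In iteration $X$ a partition $X = X_1 \,\dot\cup\, \cdots \,\dot\cup\, X_m \,\dot\cup\, X'$ with $X_1,\dots,X_m\neq\emptyset$ is formed, where $X'$ (possibly empty) is the set of elements visited directly by $X$, and the function is called recursively on $X_1,\dots,X_m$ (the children of $X$, forming $C(X)$). $T(X)$ denotes the number of instructions executed by iteration $X$ itself. A potential function $\Phi$ assigns a number $\Phi(X)>0$ to every iteration. Pyramid condition: $\mathcal{A}$ satisfies it with respect to $\Phi$ and time $T^\star>0$ if there is a constant $\mu>0$ such that for every iteration $X$, $\sum_{Y\in C(X)} \Phi(Y) + \mu |X'| - \Phi(X) \ge T(X)/T^\star$.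
   Formalization: The potential function Φ takes rational values, and the Pyramid constant μ and the time $T^\star$ are rational numbers. -}

module Defs where

open import Data.Nat as ℕ using (ℕ; zero; suc)
open import Data.Integer using (+_)
open import Data.Rational as ℚ using (ℚ; _/_; 0ℚ)
open import Data.List using (List; []; _∷_; _++_; length)
open import Data.List.Membership.Propositional using (_∈_)
open import Data.Product using (∃)
open import Relation.Binary.PropositionalEquality using (_≡_)

toℚ : ℕ → ℚ
toℚ n = (+ n) / 1

-- Recursion tree of an enumeration algorithm over elements of type A.
-- A node (= iteration) is given by the sequence of actions its own body
-- performs, in execution order: one instruction ('tick'), visiting an
-- element directly ('out a'), or a recursive call on a child ('call c').
mutual
  data Tree (A : Set) : Set where
    node : List (Action A) → Tree A

  data Action (A : Set) : Set where
    tick : Action A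
    out  : A → Action A
    call : Tree A → Action A

data Step (A : Set) : Set where
  instr : Step A
  visit : A → Step A

module _ {A : Set} where

  body : Tree A → List (Action A)
  body (node as) = as

  countTicks : List (Action A) → ℕ
  countTicks []           = 0
  countTicks (tick ∷ as)  = suc (countTicks as)
  countTicks (out _ ∷ as) = countTicks as
  countTicks (call _ ∷ as) = countTicks as

  T : Tree A → ℕ
  T t = countTicks (body t)

  directL : List (Action A) → List A
  directL []            = []
  directL (tick ∷ as)   = directL as
  directL (out a ∷ as)  = a ∷ directL as
  directL (call _ ∷ as) = directL as

  direct : Tree A → List A
  direct t = directL (body t)

  childrenL : List (Action A) → List (Tree A)
  childrenL []            = []
  childrenL (tick ∷ as)   = childrenL as
  childrenL (out _ ∷ as)  = childrenL as
  childrenL (call c ∷ as) = c ∷ childrenL as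

  children : Tree A → List (Tree A)
  children t = childrenL (body t)

  mutual
    trace : Tree A → List (Step A)
    trace (node as) = traceL as

    traceL : List (Action A) → List (Step A)
    traceL []            = []
    traceL (tick ∷ as)   = instr ∷ traceL as
    traceL (out a ∷ as)  = visit a ∷ traceL as
    traceL (call c ∷ as) = trace c ++ traceL as

  visitsOf : List (Step A) → List A
  visitsOf []            = []
  visitsOf (instr ∷ s)   = visitsOf s
  visitsOf (visit a ∷ s) = a ∷ visitsOf s

  elems : Tree A → List A
  elems t = visitsOf (trace t)

  -- number of instructions executed before the k-th element is visited
  -- (the whole run if fewer than k elements are visited)
  timeUpTo : ℕ → List (Step A) → ℕ
  timeUpTo zero    _             = 0
  timeUpTo (suc k) []            = 0
  timeUpTo (suc k) (instr ∷ s)   = suc (timeUpTo (suc k) s)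
  timeUpTo (suc k) (visit _ ∷ s) = timeUpTo k s

  timeFirst : ℕ → Tree A → ℕ
  timeFirst k root = timeUpTo k (trace root)

  data _⊑_ : Tree A → Tree A → Set where
    here  : ∀ {t} → t ⊑ t
    there : ∀ {s c t} → c ∈ children t → s ⊑ c → s ⊑ t

  data Path : Tree A → Set where
    end  : ∀ {t} → children t ≡ [] → Path t
    step : ∀ {t c} → c ∈ children t → Path c → Path t

  pathCost : ∀ {t} → Path t → ℕ
  pathCost {t} (end _)    = T t
  pathCost {t} (step _ p) = T t ℕ.+ pathCost p

  sumℚ : List ℚ → ℚ
  sumℚ []       = 0ℚ
  sumℚ (x ∷ xs) = x ℚ.+ sumℚ xs

  mapΦ : (Tree A → ℚ) → List (Tree A) → List ℚ
  mapΦ Φ []       = []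
  mapΦ Φ (c ∷ cs) = Φ c ∷ mapΦ Φ cs

  -- Pyramid condition w.r.t. Φ, time T⋆ and constant μ, at every iteration:
  --   Σ_{Y∈C(X)} Φ(Y) + μ|X'| − Φ(X) ≥ T(X)/T⋆   (multiplied through by T⋆ > 0)
  Pyramid : Tree A → (Tree A → ℚ) → (μ Tstar : ℚ) → Set
  Pyramid root Φ μ Tstar =
    ∀ X → X ⊑ root →
      toℚ (T X) ℚ.≤ Tstar ℚ.* (sumℚ (mapΦ Φ (children X)) ℚ.+ μ ℚ.* toℚ (length (direct X)) ℚ.- Φ X)

{-# OPTIONS --safe #-}
module Submission where

-- Give every visit a credit of W = T⋆·μ and every instruction a cost of 1.
-- The Pyramid condition at X says that X's own instructions and visits, with
-- each recursive call Y valued at T⋆·Φ(Y), leave a net credit of at least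
-- T⋆·Φ(X); by induction the whole run of X leaves a net credit of at least
-- T⋆·Φ(X) ≥ 0, so a completed call that visits v elements executes at most
-- W·v instructions.  Before the k-th visit the run has completed some calls,
-- which together visited fewer than k elements and so cost at most W·k, and
-- has otherwise executed parts of the bodies of the iterations on a single
-- root-to-leaf path, which cost at most Δ.  The time is thus at most
-- Δ + T⋆·μ·k ≤ (1 + μ)(k·T⋆ + Δ).

open import Defs
open import Level using (0ℓ)
import Data.Nat
open import Data.Nat as ℕ using (ℕ; zero; suc; _⊔_)
import Data.Nat.Properties as ℕ
import Data.Nat.Coprimality as Coprime
import Data.Integer as ℤ
import Data.Integer.Properties as ℤ
open import Data.Rational using (ℚ; mkℚ; 0ℚ; 1ℚ; _≤_; _<_; _+_; _*_; _-_; -_; _/_; nonNegative)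
open import Data.Rational.Properties
open import Data.List using (List; []; _∷_; _++_; length)
open import Data.List.Membership.Propositional using (_∈_)
open import Data.List.Relation.Unary.Any using (here; there)
open import Data.List.Relation.Unary.Unique.Propositional using (Unique)
open import Data.List.Relation.Binary.Permutation.Propositional using (_↭_)
open import Data.Product using (Σ; _,_; _×_)
open import Data.Sum using (_⊎_; inj₁; inj₂)
open import Relation.Nullary using (yes; no)
open import Relation.Nullary.Decidable using (dec⇒maybe)
open import Relation.Binary.PropositionalEquality using (_≡_; _≢_; refl; sym; trans; cong; cong₂; module ≡-Reasoning)
open import Tactic.RingSolver using (solve-∀)
open import Tactic.RingSolver.Core.AlmostCommutativeRing using (AlmostCommutativeRing; fromCommutativeRing)

ℚ-ring : AlmostCommutativeRing 0ℓ 0ℓ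
ℚ-ring = fromCommutativeRing +-*-commutativeRing (λ x → dec⇒maybe (0ℚ ≟ x))

p≤p+q : ∀ {p q} → 0ℚ ≤ q → p ≤ p + q
p≤p+q {p} {q} 0≤q = begin
  p        ≡⟨ +-identityʳ p ⟨
  p + 0ℚ   ≤⟨ +-monoʳ-≤ p 0≤q ⟩
  p + q    ∎
  where open ≤-Reasoning

0≤p*q : ∀ {p q} → 0ℚ ≤ p → 0ℚ ≤ q → 0ℚ ≤ p * q
0≤p*q {p} {q} 0≤p 0≤q = nonNegative⁻¹ (p * q) {{nonNeg*nonNeg⇒nonNeg p {{nonNegative 0≤p}} q {{nonNegative 0≤q}}}}

p≤q-r⇒r≤q-p : ∀ {p q r} → p ≤ q - r → r ≤ q - p
p≤q-r⇒r≤q-p {p} {q} {r} p≤q-r = begin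
  r                      ≡⟨ split p r ⟩
  p + (r - p)            ≤⟨ +-monoˡ-≤ (r - p) p≤q-r ⟩
  (q - r) + (r - p)      ≡⟨ telescope q r p ⟩
  q - p                  ∎
  where
  open ≤-Reasoning
  split : ∀ p r → r ≡ p + (r - p)
  split = solve-∀ ℚ-ring
  telescope : ∀ q r p → (q - r) + (r - p) ≡ q - p
  telescope = solve-∀ ℚ-ring

toℚ≡mkℚ : ∀ n → toℚ n ≡ mkℚ (ℤ.+ n) 0 (Coprime.sym (Coprime.1-coprimeTo n))
toℚ≡mkℚ n = normalize-coprime (Coprime.sym (Coprime.1-coprimeTo n))

toℚ-+ : ∀ m n → toℚ (m ℕ.+ n) ≡ toℚ m + toℚ n
toℚ-+ m n = begin
  toℚ (m ℕ.+ n)                                  ≡⟨ cong₂ (λ i j → (i ℤ.+ j) / 1) (ℤ.*-identityʳ (ℤ.+ m)) (ℤ.*-identityʳ (ℤ.+ n)) ⟨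
  (ℤ.+ m ℤ.* ℤ.+ 1 ℤ.+ ℤ.+ n ℤ.* ℤ.+ 1) / 1      ≡⟨ cong₂ _+_ (toℚ≡mkℚ m) (toℚ≡mkℚ n) ⟨
  toℚ m + toℚ n                                  ∎
  where open ≡-Reasoning

toℚ-suc : ∀ n → toℚ (suc n) ≡ 1ℚ + toℚ n
toℚ-suc = toℚ-+ 1

0≤toℚ : ∀ n → 0ℚ ≤ toℚ n
0≤toℚ n = nonNegative⁻¹ (toℚ n) {{normalize-nonNeg n 1}}

toℚ-mono-≤ : ∀ {m n} → m ℕ.≤ n → toℚ m ≤ toℚ n
toℚ-mono-≤ {m} {n} m≤n = begin
  toℚ m                   ≤⟨ p≤p+q (0≤toℚ (n ℕ.∸ m)) ⟩
  toℚ m + toℚ (n ℕ.∸ m)   ≡⟨ toℚ-+ m (n ℕ.∸ m) ⟨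
  toℚ (m ℕ.+ (n ℕ.∸ m))   ≡⟨ cong toℚ (ℕ.m+[n∸m]≡n m≤n) ⟩
  toℚ n                   ∎
  where open ≤-Reasoning

toℚ-suc-≤ : ∀ m n x → toℚ m ≤ toℚ n + x → toℚ (suc m) ≤ toℚ (suc n) + x
toℚ-suc-≤ m n x m≤n+x = begin
  toℚ (suc m)          ≡⟨ toℚ-suc m ⟩
  1ℚ + toℚ m           ≤⟨ +-monoʳ-≤ 1ℚ m≤n+x ⟩
  1ℚ + (toℚ n + x)     ≡⟨ +-assoc 1ℚ (toℚ n) x ⟨
  (1ℚ + toℚ n) + x     ≡⟨ cong (_+ x) (toℚ-suc n) ⟨
  toℚ (suc n) + x      ∎
  where open ≤-Reasoning

module _ {A : Set} where

  instrs : List (Step A) → ℕ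
  instrs []            = 0
  instrs (instr ∷ s)   = suc (instrs s)
  instrs (visit _ ∷ s) = instrs s

  visits : List (Step A) → ℕ
  visits []            = 0
  visits (instr ∷ s)   = visits s
  visits (visit _ ∷ s) = suc (visits s)

  timeUpTo-++-within : ∀ k s t → k ℕ.≤ visits s → timeUpTo k (s ++ t) ≡ timeUpTo k s
  timeUpTo-++-within zero    s             t _         = refl
  timeUpTo-++-within (suc k) (instr ∷ s)   t k≤v       = cong suc (timeUpTo-++-within (suc k) s t k≤v)
  timeUpTo-++-within (suc k) (visit _ ∷ s) t (ℕ.s≤s k≤v) = timeUpTo-++-within k s t k≤v

  timeUpTo-++-beyond : ∀ k s t → visits s ℕ.< k →
                       timeUpTo k (s ++ t) ≡ instrs s ℕ.+ timeUpTo (k ℕ.∸ visits s) t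
  timeUpTo-++-beyond k       []            t _         = refl
  timeUpTo-++-beyond (suc k) (instr ∷ s)   t v<k       = cong suc (timeUpTo-++-beyond (suc k) s t v<k)
  timeUpTo-++-beyond (suc k) (visit _ ∷ s) t (ℕ.s≤s v<k) = timeUpTo-++-beyond k s t v<k

  stepCredit : ℚ → Step A → ℚ
  stepCredit W instr     = - 1ℚ
  stepCredit W (visit _) = W

  credit : ℚ → List (Step A) → ℚ
  credit W []      = 0ℚ
  credit W (x ∷ s) = stepCredit W x + credit W s

  credit-++ : ∀ W s t → credit W (s ++ t) ≡ credit W s + credit W t
  credit-++ W []      t = sym (+-identityˡ (credit W t))
  credit-++ W (x ∷ s) t = trans (cong (stepCredit W x +_) (credit-++ W s t))
                                (sym (+-assoc (stepCredit W x) (credit W s) (credit W t)))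

  instrs+credit≡W*visits : ∀ W s → toℚ (instrs s) + credit W s ≡ W * toℚ (visits s)
  instrs+credit≡W*visits W [] = sym (*-zeroʳ W)
  instrs+credit≡W*visits W (instr ∷ s) = begin
    toℚ (suc i) + (- 1ℚ + c)    ≡⟨ cong (_+ (- 1ℚ + c)) (toℚ-suc i) ⟩
    (1ℚ + toℚ i) + (- 1ℚ + c)   ≡⟨ cancel (toℚ i) c ⟩
    toℚ i + c                   ≡⟨ instrs+credit≡W*visits W s ⟩
    W * toℚ (visits s)          ∎
    where
    open ≡-Reasoning
    i = instrs s
    c = credit W s
    cancel : ∀ a b → (1ℚ + a) + (- 1ℚ + b) ≡ a + b
    cancel = solve-∀ ℚ-ring
  instrs+credit≡W*visits W (visit _ ∷ s) = begin
    toℚ i + (W + c)             ≡⟨ exchange W (toℚ i) c ⟩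
    W + (toℚ i + c)             ≡⟨ cong (W +_) (instrs+credit≡W*visits W s) ⟩
    W + W * toℚ v               ≡⟨ distrib W (toℚ v) ⟩
    W * (1ℚ + toℚ v)            ≡⟨ cong (W *_) (toℚ-suc v) ⟨
    W * toℚ (suc v)             ∎
    where
    open ≡-Reasoning
    i = instrs s
    v = visits s
    c = credit W s
    exchange : ∀ w a b → a + (w + b) ≡ w + (a + b)
    exchange = solve-∀ ℚ-ring
    distrib : ∀ w x → w + w * x ≡ w * (1ℚ + x)
    distrib = solve-∀ ℚ-ring

  instrs≤W*visits : ∀ W s → 0ℚ ≤ credit W s → toℚ (instrs s) ≤ W * toℚ (visits s)
  instrs≤W*visits W s 0≤credit = begin
    toℚ (instrs s)                 ≤⟨ p≤p+q 0≤credit ⟩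
    toℚ (instrs s) + credit W s    ≡⟨ instrs+credit≡W*visits W s ⟩
    W * toℚ (visits s)             ∎
    where open ≤-Reasoning

  Everywhere : (Tree A → Set) → Tree A → Set
  Everywhere P r = ∀ X → X ⊑ r → P X

  ⊑-trans : ∀ {X Y Z : Tree A} → X ⊑ Y → Y ⊑ Z → X ⊑ Z
  ⊑-trans X⊑Y here            = X⊑Y
  ⊑-trans X⊑Y (there c∈ Y⊑c) = there c∈ (⊑-trans X⊑Y Y⊑c)

  Everywhere-⊑ : ∀ {P} {X r : Tree A} → Everywhere P r → X ⊑ r → Everywhere P X
  Everywhere-⊑ h X⊑r Y Y⊑X = h Y (⊑-trans Y⊑X X⊑r)

  Everywhere-child : ∀ {P} {X c : Tree A} → Everywhere P X → c ∈ children X → Everywhere P c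
  Everywhere-child h c∈ = Everywhere-⊑ h (there c∈ here)

  mutual
    maxPathCost : Tree A → ℕ
    maxPathCost (node as) = countTicks as ℕ.+ maxCallPathCost as

    maxCallPathCost : List (Action A) → ℕ
    maxCallPathCost []            = 0
    maxCallPathCost (tick ∷ as)   = maxCallPathCost as
    maxCallPathCost (out _ ∷ as)  = maxCallPathCost as
    maxCallPathCost (call c ∷ as) = maxPathCost c ⊔ maxCallPathCost as

  mutual
    maxPathCost-attained : ∀ X → Σ (Path X) λ p → maxPathCost X ℕ.≤ pathCost p
    maxPathCost-attained (node as) with maxCallPathCost-attained as
    ... | inj₁ (noCalls , m≡0)    = end noCalls , ℕ.≤-reflexive (trans (cong (countTicks as ℕ.+_) m≡0) (ℕ.+-identityʳ _))
    ... | inj₂ (c , c∈ , p , m≤p) = step c∈ p , ℕ.+-monoʳ-≤ (countTicks as) m≤p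

    maxCallPathCost-attained : ∀ as → (childrenL as ≡ [] × maxCallPathCost as ≡ 0)
                               ⊎ Σ (Tree A) λ c → c ∈ childrenL as × Σ (Path c) λ p → maxCallPathCost as ℕ.≤ pathCost p
    maxCallPathCost-attained []            = inj₁ (refl , refl)
    maxCallPathCost-attained (tick ∷ as)   = maxCallPathCost-attained as
    maxCallPathCost-attained (out _ ∷ as)  = maxCallPathCost-attained as
    maxCallPathCost-attained (call c ∷ as) with maxPathCost-attained c | maxCallPathCost-attained as
    ... | p , c≤p | inj₁ (_ , m≡0) =
      inj₂ (c , here refl , p , ℕ.⊔-lub c≤p (ℕ.≤-trans (ℕ.≤-reflexive m≡0) ℕ.z≤n))
    ... | p , c≤p | inj₂ (c′ , c′∈ , p′ , m≤p′) with ℕ.≤-total (pathCost p) (pathCost p′)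
    ...   | inj₁ p≤p′ = inj₂ (c′ , there c′∈ , p′ , ℕ.⊔-lub (ℕ.≤-trans c≤p p≤p′) m≤p′)
    ...   | inj₂ p′≤p = inj₂ (c , here refl , p , ℕ.⊔-lub c≤p (ℕ.≤-trans m≤p′ p′≤p))

  Amortised : ℚ → Tree A → Set
  Amortised W X = toℚ (instrs (trace X)) ≤ W * toℚ (visits (trace X))

  module _ {W : ℚ} (0≤W : 0ℚ ≤ W) where

    private
      0≤toℚ+W*toℚ : ∀ m n → 0ℚ ≤ toℚ m + W * toℚ n
      0≤toℚ+W*toℚ m n = +-mono-≤ (0≤toℚ m) (0≤p*q 0≤W (0≤toℚ n))

      W*toℚ-mono-≤ : ∀ {m n} → m ℕ.≤ n → W * toℚ m ≤ W * toℚ n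
      W*toℚ-mono-≤ m≤n = *-monoˡ-≤-nonNeg W {{nonNegative 0≤W}} (toℚ-mono-≤ m≤n)

      toℚ-+-≤ : ∀ i τ v r b → toℚ i ≤ W * toℚ v → toℚ τ ≤ toℚ b + W * toℚ r →
                toℚ (i ℕ.+ τ) ≤ toℚ b + W * toℚ (v ℕ.+ r)
      toℚ-+-≤ i τ v r b i≤Wv τ≤b+Wr = begin
        toℚ (i ℕ.+ τ)                      ≡⟨ toℚ-+ i τ ⟩
        toℚ i + toℚ τ                      ≤⟨ +-mono-≤ i≤Wv τ≤b+Wr ⟩
        W * toℚ v + (toℚ b + W * toℚ r)    ≡⟨ regroup W (toℚ v) (toℚ b) (toℚ r) ⟩
        toℚ b + W * (toℚ v + toℚ r)        ≡⟨ cong (λ x → toℚ b + W * x) (toℚ-+ v r) ⟨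
        toℚ b + W * toℚ (v ℕ.+ r)          ∎
        where
        open ≤-Reasoning
        regroup : ∀ w x b y → w * x + (b + w * y) ≡ b + w * (x + y)
        regroup = solve-∀ ℚ-ring

    mutual
      timeUpTo-trace≤ : ∀ {X} → Everywhere (Amortised W) X → ∀ k →
                        toℚ (timeUpTo k (trace X)) ≤ toℚ (maxPathCost X) + W * toℚ k
      timeUpTo-trace≤ {node as} am = timeUpTo-traceL≤ as (Everywhere-child am)

      timeUpTo-traceL≤ : ∀ as → (∀ {c} → c ∈ childrenL as → Everywhere (Amortised W) c) → ∀ k →
                         toℚ (timeUpTo k (traceL as)) ≤ toℚ (countTicks as ℕ.+ maxCallPathCost as) + W * toℚ k
      timeUpTo-traceL≤ as am zero = 0≤toℚ+W*toℚ (countTicks as ℕ.+ maxCallPathCost as) 0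
      timeUpTo-traceL≤ [] am (suc k) = 0≤toℚ+W*toℚ 0 (suc k)
      timeUpTo-traceL≤ (tick ∷ as) am k@(suc _) =
        toℚ-suc-≤ (timeUpTo k (traceL as)) (countTicks as ℕ.+ maxCallPathCost as) (W * toℚ k) (timeUpTo-traceL≤ as am k)
      timeUpTo-traceL≤ (out _ ∷ as) am (suc k) =
        ≤-trans (timeUpTo-traceL≤ as am k) (+-monoʳ-≤ (toℚ (countTicks as ℕ.+ maxCallPathCost as)) (W*toℚ-mono-≤ (ℕ.n≤1+n k)))
      timeUpTo-traceL≤ (call c ∷ as) am k@(suc _) with k ℕ.≤? visits (trace c)
      ... | yes k≤v = begin
        toℚ (timeUpTo k (trace c ++ traceL as))  ≡⟨ cong toℚ (timeUpTo-++-within k (trace c) (traceL as) k≤v) ⟩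
        toℚ (timeUpTo k (trace c))               ≤⟨ timeUpTo-trace≤ (am (here refl)) k ⟩
        toℚ (maxPathCost c) + W * toℚ k          ≤⟨ +-monoˡ-≤ (W * toℚ k) (toℚ-mono-≤ c≤b′) ⟩
        toℚ b′ + W * toℚ k                       ∎
        where
        open ≤-Reasoning
        b′ = countTicks as ℕ.+ (maxPathCost c ⊔ maxCallPathCost as)
        c≤b′ : maxPathCost c ℕ.≤ b′
        c≤b′ = ℕ.≤-trans (ℕ.m≤m⊔n _ _) (ℕ.m≤n+m _ (countTicks as))
      ... | no k≰v = begin
        toℚ (timeUpTo k (trace c ++ traceL as))  ≡⟨ cong toℚ (timeUpTo-++-beyond k (trace c) (traceL as) v<k) ⟩
        toℚ (i ℕ.+ τ)                            ≤⟨ toℚ-+-≤ i τ v r b (am (here refl) c here)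
                                                      (timeUpTo-traceL≤ as (λ c∈ → am (there c∈)) r) ⟩
        toℚ b + W * toℚ (v ℕ.+ r)                ≡⟨ cong (λ n → toℚ b + W * toℚ n) (ℕ.m+[n∸m]≡n (ℕ.<⇒≤ v<k)) ⟩
        toℚ b + W * toℚ k                        ≤⟨ +-monoˡ-≤ (W * toℚ k) (toℚ-mono-≤ b≤b′) ⟩
        toℚ b′ + W * toℚ k                       ∎
        where
        open ≤-Reasoning
        i = instrs (trace c)
        v = visits (trace c)
        r = k ℕ.∸ v
        τ = timeUpTo r (traceL as)
        v<k : v ℕ.< k
        v<k = ℕ.≰⇒> k≰v
        b = countTicks as ℕ.+ maxCallPathCost as
        b′ = countTicks as ℕ.+ (maxPathCost c ⊔ maxCallPathCost as)
        b≤b′ : b ℕ.≤ b′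
        b≤b′ = ℕ.+-monoʳ-≤ (countTicks as) (ℕ.m≤n⊔m (maxPathCost c) (maxCallPathCost as))

module _ {A : Set} (Φ : Tree A → ℚ) (μ Tstar : ℚ) where

  PyramidAt : Tree A → Set
  PyramidAt X = toℚ (T X) ≤ Tstar * (sumℚ {A} (mapΦ Φ (children X)) + μ * toℚ (length (direct X)) - Φ X)

  bodyCredit : List (Action A) → ℚ
  bodyCredit []            = 0ℚ
  bodyCredit (tick ∷ as)   = - 1ℚ + bodyCredit as
  bodyCredit (out _ ∷ as)  = Tstar * μ + bodyCredit as
  bodyCredit (call c ∷ as) = Tstar * Φ c + bodyCredit as

  bodyCredit-explicit : ∀ as → bodyCredit as ≡
                        Tstar * (sumℚ {A} (mapΦ Φ (childrenL as)) + μ * toℚ (length (directL as))) - toℚ (countTicks as)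
  bodyCredit-explicit [] = empty Tstar μ
    where
    empty : ∀ t m → 0ℚ ≡ t * (0ℚ + m * 0ℚ) - 0ℚ
    empty = solve-∀ ℚ-ring
  bodyCredit-explicit (tick ∷ as) = begin
    - 1ℚ + bodyCredit as     ≡⟨ cong (- 1ℚ +_) (bodyCredit-explicit as) ⟩
    - 1ℚ + (x - toℚ t)       ≡⟨ shift x (toℚ t) ⟩
    x - (1ℚ + toℚ t)         ≡⟨ cong (λ y → x - y) (toℚ-suc t) ⟨
    x - toℚ (suc t)          ∎
    where
    open ≡-Reasoning
    x = Tstar * (sumℚ {A} (mapΦ Φ (childrenL as)) + μ * toℚ (length (directL as)))
    t = countTicks as
    shift : ∀ a b → - 1ℚ + (a - b) ≡ a - (1ℚ + b)
    shift = solve-∀ ℚ-ring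
  bodyCredit-explicit (out _ ∷ as) = begin
    Tstar * μ + bodyCredit as                 ≡⟨ cong (Tstar * μ +_) (bodyCredit-explicit as) ⟩
    Tstar * μ + (Tstar * (S + μ * d) - t)     ≡⟨ absorb Tstar μ S d t ⟩
    Tstar * (S + μ * (1ℚ + d)) - t            ≡⟨ cong (λ y → Tstar * (S + μ * y) - t) (toℚ-suc (length (directL as))) ⟨
    Tstar * (S + μ * toℚ (suc (length (directL as)))) - t ∎
    where
    open ≡-Reasoning
    S = sumℚ {A} (mapΦ Φ (childrenL as))
    d = toℚ (length (directL as))
    t = toℚ (countTicks as)
    absorb : ∀ T m s d t → T * m + (T * (s + m * d) - t) ≡ T * (s + m * (1ℚ + d)) - t
    absorb = solve-∀ ℚ-ring
  bodyCredit-explicit (call c ∷ as) = begin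
    Tstar * Φ c + bodyCredit as               ≡⟨ cong (Tstar * Φ c +_) (bodyCredit-explicit as) ⟩
    Tstar * Φ c + (Tstar * (S + y) - t)       ≡⟨ absorb Tstar (Φ c) S y t ⟩
    Tstar * ((Φ c + S) + y) - t               ∎
    where
    open ≡-Reasoning
    S = sumℚ {A} (mapΦ Φ (childrenL as))
    y = μ * toℚ (length (directL as))
    t = toℚ (countTicks as)
    absorb : ∀ T f s y t → T * f + (T * (s + y) - t) ≡ T * ((f + s) + y) - t
    absorb = solve-∀ ℚ-ring

  Tstar*Φ≤bodyCredit : ∀ {as} → PyramidAt (node as) → Tstar * Φ (node as) ≤ bodyCredit as
  Tstar*Φ≤bodyCredit {as} pyramid = begin
    Tstar * Φ (node as)                ≤⟨ p≤q-r⇒r≤q-p {q = Tstar * x} (≤-trans pyramid (≤-reflexive (distrib Tstar x (Φ (node as))))) ⟩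
    Tstar * x - toℚ (countTicks as)    ≡⟨ bodyCredit-explicit as ⟨
    bodyCredit as                      ∎
    where
    open ≤-Reasoning
    x = sumℚ {A} (mapΦ Φ (childrenL as)) + μ * toℚ (length (directL as))
    distrib : ∀ T a f → T * (a - f) ≡ T * a - T * f
    distrib = solve-∀ ℚ-ring

  mutual
    Tstar*Φ≤credit : ∀ {X} → Everywhere PyramidAt X → Tstar * Φ X ≤ credit (Tstar * μ) (trace X)
    Tstar*Φ≤credit {node as} pyramid =
      ≤-trans (Tstar*Φ≤bodyCredit (pyramid (node as) here)) (bodyCredit≤credit as (Everywhere-child pyramid))

    bodyCredit≤credit : ∀ as → (∀ {c} → c ∈ childrenL as → Everywhere PyramidAt c) →
                        bodyCredit as ≤ credit (Tstar * μ) (traceL as)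
    bodyCredit≤credit []            pyramid = ≤-refl
    bodyCredit≤credit (tick ∷ as)   pyramid = +-monoʳ-≤ (- 1ℚ) (bodyCredit≤credit as pyramid)
    bodyCredit≤credit (out _ ∷ as)  pyramid = +-monoʳ-≤ (Tstar * μ) (bodyCredit≤credit as pyramid)
    bodyCredit≤credit (call c ∷ as) pyramid = begin
      Tstar * Φ c + bodyCredit as                                   ≤⟨ +-mono-≤ (Tstar*Φ≤credit (pyramid (here refl)))
                                                                                 (bodyCredit≤credit as (λ c∈ → pyramid (there c∈))) ⟩
      credit (Tstar * μ) (trace c) + credit (Tstar * μ) (traceL as) ≡⟨ credit-++ (Tstar * μ) (trace c) (traceL as) ⟨
      credit (Tstar * μ) (trace c ++ traceL as)                     ∎
      where open ≤-Reasoning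

timeFirst≤Δ+Tstar*μ*k : ∀ {A : Set} (root : Tree A) (Φ : Tree A → ℚ) (μ Tstar : ℚ) (Δ : ℕ) →
                        Everywhere (λ X → 0ℚ ≤ Φ X) root → 0ℚ ≤ μ → 0ℚ ≤ Tstar →
                        Pyramid root Φ μ Tstar → (∀ (p : Path root) → pathCost p ℕ.≤ Δ) →
                        ∀ k → toℚ (timeFirst k root) ≤ toℚ Δ + Tstar * μ * toℚ k
timeFirst≤Δ+Tstar*μ*k root Φ μ Tstar Δ 0≤Φ 0≤μ 0≤Tstar pyramid cost≤Δ k = begin
  toℚ (timeFirst k root)                       ≤⟨ timeUpTo-trace≤ (0≤p*q 0≤Tstar 0≤μ) amortised k ⟩
  toℚ (maxPathCost root) + Tstar * μ * toℚ k   ≤⟨ +-monoˡ-≤ (Tstar * μ * toℚ k) (toℚ-mono-≤ maxPathCost≤Δ) ⟩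
  toℚ Δ + Tstar * μ * toℚ k                    ∎
  where
  open ≤-Reasoning
  amortised : Everywhere (Amortised (Tstar * μ)) root
  amortised X X⊑root = instrs≤W*visits (Tstar * μ) (trace X)
    (≤-trans (0≤p*q 0≤Tstar (0≤Φ X X⊑root)) (Tstar*Φ≤credit Φ μ Tstar (Everywhere-⊑ pyramid X⊑root)))
  maxPathCost≤Δ : maxPathCost root ℕ.≤ Δ
  maxPathCost≤Δ = let p , max≤p = maxPathCost-attained root in ℕ.≤-trans max≤p (cost≤Δ p)

theorem2p6 : Σ (ℚ → ℚ) λ C →
    ∀ {A : Set} (S : List A) (root : Tree A) (Φ : Tree A → ℚ) (μ Tstar : ℚ) (Δ : ℕ) →
    Unique S → elems root ↭ S →
    (∀ X → X ⊑ root → ∀ Y → Y ∈ children X → elems Y ≢ []) →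
    (∀ X → X ⊑ root → 0ℚ < Φ X) → 0ℚ < μ → 0ℚ < Tstar →
    Pyramid root Φ μ Tstar →
    (∀ (p : Path root) → pathCost p Data.Nat.≤ Δ) →
    ∀ (k : ℕ) → toℚ (timeFirst k root) ≤ C μ * (toℚ k * Tstar + toℚ Δ)
theorem2p6 = (λ μ → 1ℚ + μ) , λ S root Φ μ Tstar Δ _ _ _ 0<Φ 0<μ 0<Tstar pyramid cost≤Δ k →
  let 0≤μ = <⇒≤ 0<μ; 0≤Tstar = <⇒≤ 0<Tstar in begin
  toℚ (timeFirst k root)
    ≤⟨ timeFirst≤Δ+Tstar*μ*k root Φ μ Tstar Δ (λ X X⊑root → <⇒≤ (0<Φ X X⊑root)) 0≤μ 0≤Tstar pyramid cost≤Δ k ⟩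
  toℚ Δ + Tstar * μ * toℚ k
    ≤⟨ p≤p+q (+-mono-≤ (0≤p*q (0≤toℚ k) 0≤Tstar) (0≤p*q 0≤μ (0≤toℚ Δ))) ⟩
  (toℚ Δ + Tstar * μ * toℚ k) + (toℚ k * Tstar + μ * toℚ Δ)
    ≡⟨ expand (toℚ Δ) Tstar μ (toℚ k) ⟩
  (1ℚ + μ) * (toℚ k * Tstar + toℚ Δ) ∎
  where
  open ≤-Reasoning
  expand : ∀ D T m K → (D + T * m * K) + (K * T + m * D) ≡ (1ℚ + m) * (K * T + D)
  expand = solve-∀ ℚ-ring
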